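{- Let $D(x)=1-2x-2x^2+x^3$ and define integer sequences by the formal power series expansions \[ \frac{4-16x+12x^2}{D(x)}=\sum_{n\ge0}a_nx^n,\ \frac{3+6x-9x^2}{D(x)}=\sum_{n\ge0}b_nx^n,\ \frac{2-20x+6x^2}{D(x)}=\sum_{n\ge0}c_nx^n, \] \[ \frac{4+8x-12x^2}{D(x)}=\sum_{n\ge0}d_nx^n,\ \frac{2+4x+6x^2}{D(x)}=\sum_{n\ge0}e_nx^n,\ \frac{5+10x-15x^2}{D(x)}=\sum_{n\ge0}f_nx^n. \] Then for all $n\ge0$, $a_n^4+b_n^4+c_n^4+d_n^4+e_n^4=f_n^4$. -}

module Defs where

open import Data.Integer using (ℤ; +_; -[1+_]; _+_; _*_; _-_; 0ℤ)
open import Data.Nat using (ℕ; zero; suc)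
open import Data.Product using (_×_; _,_; proj₁)

-- The denominator D(x) = 1 - 2x - 2x^2 + x^3.
-- For a numerator N(x) = p0 + p1 x + p2 x^2, the formal power series
-- S(x) = N(x)/D(x) = Σ s_n x^n is the unique series with D(x) S(x) = N(x),
-- i.e. comparing coefficients of x^n:
--   s_n - 2 s_{n-1} - 2 s_{n-2} + s_{n-3} = N_n   (s_k = 0 for k < 0, N_n = 0 for n ≥ 3),
-- so  s_n = N_n + 2 s_{n-1} + 2 s_{n-2} - s_{n-3}.

numCoeff : ℤ → ℤ → ℤ → ℕ → ℤ
numCoeff p0 p1 p2 0 = p0
numCoeff p0 p1 p2 1 = p1
numCoeff p0 p1 p2 2 = p2
numCoeff p0 p1 p2 (suc (suc (suc _))) = 0ℤ

-- window (s_n, s_{n-1}, s_{n-2}) with s_k = 0 for k < 0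
window : ℤ → ℤ → ℤ → ℕ → ℤ × ℤ × ℤ
window p0 p1 p2 zero = (p0 , 0ℤ , 0ℤ)
window p0 p1 p2 (suc n) with window p0 p1 p2 n
... | (s , s₁ , s₂) =
  (numCoeff p0 p1 p2 (suc n) + (+ 2) * s + (+ 2) * s₁ - s₂ , s , s₁)

seriesCoeff : ℤ → ℤ → ℤ → ℕ → ℤ
seriesCoeff p0 p1 p2 n = proj₁ (window p0 p1 p2 n)

neg : ℕ → ℤ
neg zero = 0ℤ
neg (suc n) = -[1+ n ]

a b c d e f : ℕ → ℤ
a = seriesCoeff (+ 4) (neg 16) (+ 12)
b = seriesCoeff (+ 3) (+ 6) (neg 9)
c = seriesCoeff (+ 2) (neg 20) (+ 6)
d = seriesCoeff (+ 4) (+ 8) (neg 12)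
e = seriesCoeff (+ 2) (+ 4) (+ 6)
f = seriesCoeff (+ 5) (+ 10) (neg 15)

-- Since b, d, f are 3g, 4g, 5g for g = (1 + 2x - 3x²)/D and a = c + e, the identity
-- (u + v)⁴ + u⁴ + v⁴ = 2(u² + uv + v²)² together with 2·12² + 3⁴ + 4⁴ = 5⁴ reduces
-- the theorem to c² + ce + e² = 12g². Every coefficient sequence N/D is a fixed linear
-- form in the window (Xₙ, Xₙ₋₁, Xₙ₋₂) of the coefficients of 1/D, and under this
-- correspondence the quadratic relation becomes (Xₙ - Xₙ₋₁)(Xₙ₋₁ - Xₙ₋₂) = Xₙ₋₁²,
-- a Cassini-type identity that is preserved by the recurrence.
module Submission where

open import Defs
open import Data.Nat using (ℕ; zero; suc)
open import Data.Integer using (ℤ; +_; _+_; _*_; _-_; _^_; 0ℤ; 1ℤ)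
open import Data.Integer.Properties using (+-identityʳ)
open import Data.Integer.Tactic.RingSolver using (solve-∀)
open import Data.Integer.Solver using (module +-*-Solver)
open +-*-Solver using (solve; _:+_; _:*_; _:^_; con; _:=_)
open import Data.Product using (_×_; _,_; proj₁; proj₂)
open import Relation.Binary.PropositionalEquality
  using (_≡_; refl; cong; cong₂; sym; trans; module ≡-Reasoning)

ℤ³ : Set
ℤ³ = ℤ × ℤ × ℤ

infixl 6 _⊕_
infixl 7 _⊛_ _·_

_⊕_ : ℤ³ → ℤ³ → ℤ³
(x , y , z) ⊕ (x′ , y′ , z′) = (x + x′ , y + y′ , z + z′)

_⊛_ : ℤ → ℤ³ → ℤ³
k ⊛ (x , y , z) = (k * x , k * y , k * z)

_·_ : ℤ³ → ℤ³ → ℤ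
(p0 , p1 , p2) · (x , y , z) = p0 * x + p1 * y + p2 * z

·-distribʳ-⊕ : ∀ p q t → (p ⊕ q) · t ≡ p · t + q · t
·-distribʳ-⊕ (p0 , p1 , p2) (q0 , q1 , q2) (x , y , z) = identity p0 p1 p2 q0 q1 q2 x y z
  where
  identity : ∀ p0 p1 p2 q0 q1 q2 x y z →
    (p0 + q0) * x + (p1 + q1) * y + (p2 + q2) * z
      ≡ (p0 * x + p1 * y + p2 * z) + (q0 * x + q1 * y + q2 * z)
  identity = solve-∀

·-⊛ : ∀ m p t → (m ⊛ p) · t ≡ m * (p · t)
·-⊛ m (p0 , p1 , p2) (x , y , z) = identity m p0 p1 p2 x y z
  where
  identity : ∀ m p0 p1 p2 x y z →
    m * p0 * x + m * p1 * y + m * p2 * z ≡ m * (p0 * x + p1 * y + p2 * z)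
  identity = solve-∀

step : ℤ → ℤ³ → ℤ³
step k (s , s₁ , s₂) = (k + + 2 * s + + 2 * s₁ - s₂ , s , s₁)

step-⊕ : ∀ k k′ t t′ → step (k + k′) (t ⊕ t′) ≡ step k t ⊕ step k′ t′
step-⊕ k k′ (x , y , z) (x′ , y′ , z′) = cong₂ _,_ (identity k k′ x y z x′ y′ z′) refl
  where
  identity : ∀ k k′ x y z x′ y′ z′ →
    k + k′ + + 2 * (x + x′) + + 2 * (y + y′) - (z + z′)
      ≡ (k + + 2 * x + + 2 * y - z) + (k′ + + 2 * x′ + + 2 * y′ - z′)
  identity = solve-∀

step-⊛ : ∀ m k t → step (m * k) (m ⊛ t) ≡ m ⊛ step k t
step-⊛ m k (x , y , z) = cong₂ _,_ (identity m k x y z) refl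
  where
  identity : ∀ m k x y z →
    m * k + + 2 * (m * x) + + 2 * (m * y) - m * z ≡ m * (k + + 2 * x + + 2 * y - z)
  identity = solve-∀

window₀ window₁ window₂ : ℕ → ℤ³
window₀ = window 1ℤ 0ℤ 0ℤ
window₁ = window 0ℤ 1ℤ 0ℤ
window₂ = window 0ℤ 0ℤ 1ℤ

numCoeff-decomposition : ∀ p0 p1 p2 k →
  numCoeff p0 p1 p2 k
    ≡ p0 * numCoeff 1ℤ 0ℤ 0ℤ k + p1 * numCoeff 0ℤ 1ℤ 0ℤ k + p2 * numCoeff 0ℤ 0ℤ 1ℤ k
numCoeff-decomposition p0 p1 p2 0 = identity p0 p1 p2
  where
  identity : ∀ p0 p1 p2 → p0 ≡ p0 * 1ℤ + p1 * 0ℤ + p2 * 0ℤ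
  identity = solve-∀
numCoeff-decomposition p0 p1 p2 1 = identity p0 p1 p2
  where
  identity : ∀ p0 p1 p2 → p1 ≡ p0 * 0ℤ + p1 * 1ℤ + p2 * 0ℤ
  identity = solve-∀
numCoeff-decomposition p0 p1 p2 2 = identity p0 p1 p2
  where
  identity : ∀ p0 p1 p2 → p2 ≡ p0 * 0ℤ + p1 * 0ℤ + p2 * 1ℤ
  identity = solve-∀
numCoeff-decomposition p0 p1 p2 (suc (suc (suc _))) = identity p0 p1 p2
  where
  identity : ∀ p0 p1 p2 → 0ℤ ≡ p0 * 0ℤ + p1 * 0ℤ + p2 * 0ℤ
  identity = solve-∀

window-decomposition : ∀ p0 p1 p2 n →
  window p0 p1 p2 n ≡ p0 ⊛ window₀ n ⊕ p1 ⊛ window₁ n ⊕ p2 ⊛ window₂ n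
window-decomposition p0 p1 p2 zero =
  cong₂ _,_ (identity₁ p0 p1 p2) (cong₂ _,_ (identity₀ p0 p1 p2) (identity₀ p0 p1 p2))
  where
  identity₁ : ∀ p0 p1 p2 → p0 ≡ p0 * 1ℤ + p1 * 0ℤ + p2 * 0ℤ
  identity₁ = solve-∀
  identity₀ : ∀ p0 p1 p2 → 0ℤ ≡ p0 * 0ℤ + p1 * 0ℤ + p2 * 0ℤ
  identity₀ = solve-∀
window-decomposition p0 p1 p2 (suc n) = begin
  step (numCoeff p0 p1 p2 (suc n)) (window p0 p1 p2 n)
    ≡⟨ cong₂ step (numCoeff-decomposition p0 p1 p2 (suc n)) (window-decomposition p0 p1 p2 n) ⟩
  step (p0 * δ₀ + p1 * δ₁ + p2 * δ₂) (p0 ⊛ w₀ ⊕ p1 ⊛ w₁ ⊕ p2 ⊛ w₂)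
    ≡⟨ step-⊕ (p0 * δ₀ + p1 * δ₁) (p2 * δ₂) (p0 ⊛ w₀ ⊕ p1 ⊛ w₁) (p2 ⊛ w₂) ⟩
  step (p0 * δ₀ + p1 * δ₁) (p0 ⊛ w₀ ⊕ p1 ⊛ w₁) ⊕ step (p2 * δ₂) (p2 ⊛ w₂)
    ≡⟨ cong₂ _⊕_ (step-⊕ (p0 * δ₀) (p1 * δ₁) (p0 ⊛ w₀) (p1 ⊛ w₁)) (step-⊛ p2 δ₂ w₂) ⟩
  step (p0 * δ₀) (p0 ⊛ w₀) ⊕ step (p1 * δ₁) (p1 ⊛ w₁) ⊕ p2 ⊛ step δ₂ w₂
    ≡⟨ cong₂ (λ s t → s ⊕ t ⊕ p2 ⊛ step δ₂ w₂) (step-⊛ p0 δ₀ w₀) (step-⊛ p1 δ₁ w₁) ⟩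
  p0 ⊛ step δ₀ w₀ ⊕ p1 ⊛ step δ₁ w₁ ⊕ p2 ⊛ step δ₂ w₂ ∎
  where
  open ≡-Reasoning
  δ₀ δ₁ δ₂ : ℤ
  δ₀ = numCoeff 1ℤ 0ℤ 0ℤ (suc n)
  δ₁ = numCoeff 0ℤ 1ℤ 0ℤ (suc n)
  δ₂ = numCoeff 0ℤ 0ℤ 1ℤ (suc n)
  w₀ w₁ w₂ : ℤ³
  w₀ = window₀ n
  w₁ = window₁ n
  w₂ = window₂ n

window-shift : ∀ p0 p1 n → window 0ℤ p0 p1 (suc n) ≡ window p0 p1 0ℤ n
window-shift p0 p1 zero = cong₂ _,_ (identity p0) refl
  where
  identity : ∀ p0 → p0 + + 2 * 0ℤ + + 2 * 0ℤ - 0ℤ ≡ p0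
  identity = solve-∀
window-shift p0 p1 (suc n) = cong₂ step (numCoeff-shift n) (window-shift p0 p1 n)
  where
  numCoeff-shift : ∀ n → numCoeff 0ℤ p0 p1 (suc (suc n)) ≡ numCoeff p0 p1 0ℤ (suc n)
  numCoeff-shift zero = refl
  numCoeff-shift (suc zero) = refl
  numCoeff-shift (suc (suc n)) = refl

window₁≡delayed-window₀ : ∀ n → proj₁ (window₁ n) ≡ proj₁ (proj₂ (window₀ n))
window₁≡delayed-window₀ zero = refl
window₁≡delayed-window₀ (suc n) = cong proj₁ (window-shift 1ℤ 0ℤ n)

window₂≡delayed-window₀ : ∀ n → proj₁ (window₂ n) ≡ proj₂ (proj₂ (window₀ n))
window₂≡delayed-window₀ zero = refl
window₂≡delayed-window₀ (suc n) =
  trans (cong proj₁ (window-shift 0ℤ 1ℤ n)) (window₁≡delayed-window₀ n)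

seriesCoeff-convolution : ∀ p0 p1 p2 n → seriesCoeff p0 p1 p2 n ≡ (p0 , p1 , p2) · window₀ n
seriesCoeff-convolution p0 p1 p2 n =
  trans (cong proj₁ (window-decomposition p0 p1 p2 n))
        (cong₂ (λ y z → p0 * proj₁ (window₀ n) + p1 * y + p2 * z)
               (window₁≡delayed-window₀ n) (window₂≡delayed-window₀ n))

seriesCoeff-+ : ∀ p0 p1 p2 q0 q1 q2 n →
  seriesCoeff (p0 + q0) (p1 + q1) (p2 + q2) n ≡ seriesCoeff p0 p1 p2 n + seriesCoeff q0 q1 q2 n
seriesCoeff-+ p0 p1 p2 q0 q1 q2 n = begin
  seriesCoeff (p0 + q0) (p1 + q1) (p2 + q2) n
    ≡⟨ seriesCoeff-convolution _ _ _ n ⟩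
  ((p0 , p1 , p2) ⊕ (q0 , q1 , q2)) · window₀ n
    ≡⟨ ·-distribʳ-⊕ (p0 , p1 , p2) (q0 , q1 , q2) (window₀ n) ⟩
  (p0 , p1 , p2) · window₀ n + (q0 , q1 , q2) · window₀ n
    ≡⟨ sym (cong₂ _+_ (seriesCoeff-convolution p0 p1 p2 n) (seriesCoeff-convolution q0 q1 q2 n)) ⟩
  seriesCoeff p0 p1 p2 n + seriesCoeff q0 q1 q2 n ∎
  where open ≡-Reasoning

seriesCoeff-* : ∀ m p0 p1 p2 n →
  seriesCoeff (m * p0) (m * p1) (m * p2) n ≡ m * seriesCoeff p0 p1 p2 n
seriesCoeff-* m p0 p1 p2 n = begin
  seriesCoeff (m * p0) (m * p1) (m * p2) n ≡⟨ seriesCoeff-convolution _ _ _ n ⟩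
  (m ⊛ (p0 , p1 , p2)) · window₀ n         ≡⟨ ·-⊛ m (p0 , p1 , p2) (window₀ n) ⟩
  m * ((p0 , p1 , p2) · window₀ n)         ≡⟨ sym (cong (m *_) (seriesCoeff-convolution p0 p1 p2 n)) ⟩
  m * seriesCoeff p0 p1 p2 n ∎
  where open ≡-Reasoning

cassiniDefect : ℤ³ → ℤ
cassiniDefect (x , y , z) = (x - y) * (y - z) - y * y

cassiniDefect-step : ∀ t → cassiniDefect (step 0ℤ t) ≡ cassiniDefect t
cassiniDefect-step (x , y , z) = identity x y z
  where
  identity : ∀ x y z →
    (0ℤ + + 2 * x + + 2 * y - z - x) * (x - y) - x * x ≡ (x - y) * (y - z) - y * y
  identity = solve-∀

window₀-suc : ∀ n → window₀ (suc n) ≡ step 0ℤ (window₀ n)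
window₀-suc zero = refl
window₀-suc (suc zero) = refl
window₀-suc (suc (suc n)) = refl

cassiniDefect-window₀ : ∀ n → cassiniDefect (window₀ n) ≡ 0ℤ
cassiniDefect-window₀ zero = refl
cassiniDefect-window₀ (suc n) = begin
  cassiniDefect (window₀ (suc n))     ≡⟨ cong cassiniDefect (window₀-suc n) ⟩
  cassiniDefect (step 0ℤ (window₀ n)) ≡⟨ cassiniDefect-step (window₀ n) ⟩
  cassiniDefect (window₀ n)           ≡⟨ cassiniDefect-window₀ n ⟩
  0ℤ                                  ∎
  where open ≡-Reasoning

g : ℕ → ℤ
g = seriesCoeff 1ℤ (+ 2) (neg 3)

a≡c+e : ∀ n → a n ≡ c n + e n
a≡c+e = seriesCoeff-+ (+ 2) (neg 20) (+ 6) (+ 2) (+ 4) (+ 6)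

b≡3g : ∀ n → b n ≡ + 3 * g n
b≡3g = seriesCoeff-* (+ 3) 1ℤ (+ 2) (neg 3)

d≡4g : ∀ n → d n ≡ + 4 * g n
d≡4g = seriesCoeff-* (+ 4) 1ℤ (+ 2) (neg 3)

f≡5g : ∀ n → f n ≡ + 5 * g n
f≡5g = seriesCoeff-* (+ 5) 1ℤ (+ 2) (neg 3)

cassini⇒norm-identity : ∀ t → cassiniDefect t ≡ 0ℤ →
  let u = (+ 2 , neg 20 , + 6) · t
      v = (+ 2 , + 4 , + 6) · t
      w = (1ℤ , + 2 , neg 3) · t
  in u * u + u * v + v * v ≡ + 12 * (w * w)
cassini⇒norm-identity (x , y , z) defect≡0 = begin
  C * C + C * E + E * E                                     ≡⟨ +-identityʳ _ ⟨
  C * C + C * E + E * E + + 144 * 0ℤ                        ≡⟨ cong (λ δ → C * C + C * E + E * E + + 144 * δ) defect≡0 ⟨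
  C * C + C * E + E * E + + 144 * cassiniDefect (x , y , z) ≡⟨ identity x y z ⟩
  + 12 * (G * G)                                            ∎
  where
  open ≡-Reasoning
  C E G : ℤ
  C = + 2 * x + neg 20 * y + + 6 * z
  E = + 2 * x + + 4 * y + + 6 * z
  G = 1ℤ * x + + 2 * y + neg 3 * z
  identity : ∀ x y z →
    (+ 2 * x + neg 20 * y + + 6 * z) * (+ 2 * x + neg 20 * y + + 6 * z)
      + (+ 2 * x + neg 20 * y + + 6 * z) * (+ 2 * x + + 4 * y + + 6 * z)
      + (+ 2 * x + + 4 * y + + 6 * z) * (+ 2 * x + + 4 * y + + 6 * z)
      + + 144 * ((x - y) * (y - z) - y * y)
    ≡ + 12 * ((1ℤ * x + + 2 * y + neg 3 * z) * (1ℤ * x + + 2 * y + neg 3 * z))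
  identity = solve-∀

c²+ce+e²≡12g² : ∀ n → c n * c n + c n * e n + e n * e n ≡ + 12 * (g n * g n)
c²+ce+e²≡12g² n = begin
  c n * c n + c n * e n + e n * e n
    ≡⟨ cong₂ (λ u v → u * u + u * v + v * v)
             (seriesCoeff-convolution (+ 2) (neg 20) (+ 6) n)
             (seriesCoeff-convolution (+ 2) (+ 4) (+ 6) n) ⟩
  let u = (+ 2 , neg 20 , + 6) · window₀ n
      v = (+ 2 , + 4 , + 6) · window₀ n
  in u * u + u * v + v * v
    ≡⟨ cassini⇒norm-identity (window₀ n) (cassiniDefect-window₀ n) ⟩
  + 12 * (((1ℤ , + 2 , neg 3) · window₀ n) * ((1ℤ , + 2 , neg 3) · window₀ n))
    ≡⟨ cong (λ w → + 12 * (w * w)) (seriesCoeff-convolution 1ℤ (+ 2) (neg 3) n) ⟨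
  + 12 * (g n * g n) ∎
  where open ≡-Reasoning

-- Data.Integer._^_ is opaque to the reflective solver, so identities with powers use
-- the syntactic one.
[u+v]⁴+u⁴+v⁴≡2[u²+uv+v²]² : ∀ u v →
  (u + v) ^ 4 + u ^ 4 + v ^ 4 ≡ + 2 * (u * u + u * v + v * v) ^ 2
[u+v]⁴+u⁴+v⁴≡2[u²+uv+v²]² = solve 2 (λ u v →
  (u :+ v) :^ 4 :+ u :^ 4 :+ v :^ 4 := con (+ 2) :* (u :* u :+ u :* v :+ v :* v) :^ 2) refl

2[12w²]²+[3w]⁴+[4w]⁴≡[5w]⁴ : ∀ w →
  + 2 * (+ 12 * (w * w)) ^ 2 + ((+ 3 * w) ^ 4 + (+ 4 * w) ^ 4) ≡ (+ 5 * w) ^ 4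
2[12w²]²+[3w]⁴+[4w]⁴≡[5w]⁴ = solve 1 (λ w →
  con (+ 2) :* (con (+ 12) :* (w :* w)) :^ 2 :+ ((con (+ 3) :* w) :^ 4 :+ (con (+ 4) :* w) :^ 4)
    := (con (+ 5) :* w) :^ 4) refl

fourth-powers : ∀ u v w → u * u + u * v + v * v ≡ + 12 * (w * w) →
  (u + v) ^ 4 + (+ 3 * w) ^ 4 + u ^ 4 + (+ 4 * w) ^ 4 + v ^ 4 ≡ (+ 5 * w) ^ 4
fourth-powers u v w norm≡12w² = begin
  (u + v) ^ 4 + (+ 3 * w) ^ 4 + u ^ 4 + (+ 4 * w) ^ 4 + v ^ 4
    ≡⟨ regroup ((u + v) ^ 4) ((+ 3 * w) ^ 4) (u ^ 4) ((+ 4 * w) ^ 4) (v ^ 4) ⟩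
  (u + v) ^ 4 + u ^ 4 + v ^ 4 + ((+ 3 * w) ^ 4 + (+ 4 * w) ^ 4)
    ≡⟨ cong (_+ _) ([u+v]⁴+u⁴+v⁴≡2[u²+uv+v²]² u v) ⟩
  + 2 * (u * u + u * v + v * v) ^ 2 + ((+ 3 * w) ^ 4 + (+ 4 * w) ^ 4)
    ≡⟨ cong (λ N → + 2 * N ^ 2 + ((+ 3 * w) ^ 4 + (+ 4 * w) ^ 4)) norm≡12w² ⟩
  + 2 * (+ 12 * (w * w)) ^ 2 + ((+ 3 * w) ^ 4 + (+ 4 * w) ^ 4)
    ≡⟨ 2[12w²]²+[3w]⁴+[4w]⁴≡[5w]⁴ w ⟩
  (+ 5 * w) ^ 4 ∎
  where
  open ≡-Reasoning
  regroup : ∀ p q r s t → p + q + r + s + t ≡ p + r + t + (q + s)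
  regroup = solve-∀

theorem2p8 : ∀ (n : ℕ) → a n ^ 4 + b n ^ 4 + c n ^ 4 + d n ^ 4 + e n ^ 4 ≡ f n ^ 4
theorem2p8 n
  rewrite a≡c+e n | b≡3g n | d≡4g n | f≡5g n
  = fourth-powers (c n) (e n) (g n) (c²+ce+e²≡12g² n)
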